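{- Let $Q$ be a finite $\delta$-consistent poset which is saturated (any $x,y\in Q$ with $|\rho_Q(y)-\rho_Q(x)|=1$ are comparable), let $G$ be a subgroup of $\mathrm{Aut}(Q,\delta)$, and consider the quotient poset $Q/G$ with labeling $\overline\delta$. Then for any $\mathcal{O},\mathcal{O}'\in Q/G$ and any representatives $q\in\mathcal{O}$, $q'\in\mathcal{O}'$: (i) $\mathcal{O}\lessdot_{Q/G}\mathcal{O}'$ if and only if $q\lessdot_Q q'$; (ii) when these equivalent conditions hold, $\overline\delta(\mathcal{O}\lessdot\mathcal{O}')=\delta(q\lessdot q')$.
   Context: All posets are finite; $E(Q)$ is the set of covering relations. An edge labeling is $\delta\colon E(Q)\to\{ -1,1\}$; for a saturated chain $\mathcal{C}\colon p_0\lessdot\cdots\lessdot p_m$, $\delta(\mathcal{C})=\sum_i\delta(p_i\lessdot p_{i+1})$. $Q$ is $\delta$-consistent if for every $y$ the quantity $\delta(\mathcal{C})$ is the same for all maximal saturated chains $\mathcal{C}$ of $Q_{\le y}$; this value is the rank $\rho_Q(y)$. $\mathrm{Aut}(Q,\delta)$: automorphisms $\psi$ of $Q$ preserving $\delta$ on covers. The quotient poset $Q/G$ is the set of $G$-orbits with $\mathcal{O}\le\mathcal{O}'$ iff $q\le q'$ for some $q\in\mathcal{O}$, $q'\in\mathcal{O}'$. The labeling $\overline\delta$ on covers of $Q/G$ is $\overline\delta(\mathcal{O}\lessdot\mathcal{O}')=\delta(p\lessdot p')$ for any $p\in\mathcal{O}$, $p'\in\mathcal{O}'$ with $p\lessdot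 p'$ (this is well defined). -}

module Defs where

open import Data.Nat using (ℕ)
open import Data.Fin using (Fin)
open import Data.Integer using (ℤ; _+_; _-_; ∣_∣; 0ℤ; 1ℤ; -1ℤ)
open import Data.Product using (Σ; _×_; ∃)
open import Data.Sum using (_⊎_)
open import Relation.Nullary using (¬_)
open import Relation.Binary.Core using (Rel)
open import Relation.Binary.Definitions using (Decidable)
open import Relation.Binary.Structures using (IsPartialOrder)
open import Relation.Binary.PropositionalEquality using (_≡_; sym; trans; cong; cong₂; subst; subst₂)
open import Data.Product using (_,_)
import Data.Sum

record FinPoset (n : ℕ) : Set₁ where
  field
    _≤_            : Rel (Fin n) _
    isPartialOrder : IsPartialOrder _≡_ _≤_
    _≤?_           : Decidable _≤_

module _ {n : ℕ} (Q : FinPoset n) where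
  open FinPoset Q

  _<_ : Fin n → Fin n → Set
  x < y = x ≤ y × ¬ (x ≡ y)

  _⋖_ : Fin n → Fin n → Set
  x ⋖ y = x < y × (∀ z → x ≤ z → z ≤ y → z ≡ x ⊎ z ≡ y)

  -- Edge labeling: values only matter on covering relations, where they are ±1.
  IsEdgeLabeling : (Fin n → Fin n → ℤ) → Set
  IsEdgeLabeling δ = ∀ x y → x ⋖ y → δ x y ≡ 1ℤ ⊎ δ x y ≡ -1ℤ

  data SatChain : Fin n → Fin n → Set where
    single : ∀ x → SatChain x x
    step   : ∀ {x y z} → x ⋖ y → SatChain y z → SatChain x z

  chainSum : (Fin n → Fin n → ℤ) → ∀ {x y} → SatChain x y → ℤ
  chainSum δ (single x) = 0ℤ
  chainSum δ (step {x} {y} _ c) = δ x y + chainSum δ c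

  IsMinimal : Fin n → Set
  IsMinimal x = ∀ z → z ≤ x → z ≡ x

  -- A maximal saturated chain of Q_{≤y} is exactly a saturated chain from
  -- a minimal element of Q up to y.
  MaxChainBelow : Fin n → Set
  MaxChainBelow y = Σ (Fin n) λ x → IsMinimal x × SatChain x y

  -- ρ is the rank function of a δ-consistent poset: every maximal saturated
  -- chain of Q_{≤y} has δ-sum ρ y.  (Q is δ-consistent iff such ρ exists.)
  IsRankFunction : (Fin n → Fin n → ℤ) → (Fin n → ℤ) → Set
  IsRankFunction δ ρ = ∀ y x → IsMinimal x → (c : SatChain x y) → chainSum δ c ≡ ρ y

  IsSaturated : (Fin n → ℤ) → Set
  IsSaturated ρ = ∀ x y → ∣ ρ y - ρ x ∣ ≡ 1 → x ≤ y ⊎ y ≤ x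

  record Aut (δ : Fin n → Fin n → ℤ) : Set where
    field
      to       : Fin n → Fin n
      from     : Fin n → Fin n
      to-from  : ∀ x → to (from x) ≡ x
      from-to  : ∀ x → from (to x) ≡ x
      mono     : ∀ {x y} → x ≤ y → to x ≤ to y
      reflects : ∀ {x y} → to x ≤ to y → x ≤ y
      pres-δ   : ∀ {x y} → x ⋖ y → δ (to x) (to y) ≡ δ x y

  module _ {δ : Fin n → Fin n → ℤ} where
    idAut : Aut δ
    idAut = record
      { to = λ x → x ; from = λ x → x
      ; to-from = λ _ → _≡_.refl ; from-to = λ _ → _≡_.refl
      ; mono = λ p → p ; reflects = λ p → p ; pres-δ = λ _ → _≡_.refl }

    _∘A_ : Aut δ → Aut δ → Aut δ
    g ∘A h = record
      { to = λ x → G.to (H.to x) ; from = λ x → H.from (G.from x)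
      ; to-from = λ x → trans (cong G.to (H.to-from (G.from x))) (G.to-from x)
      ; from-to = λ x → trans (cong H.from (G.from-to (H.to x))) (H.from-to x)
      ; mono = λ p → G.mono (H.mono p)
      ; reflects = λ p → H.reflects (G.reflects p)
      ; pres-δ = λ {x} {y} c → trans (G.pres-δ (autCover h c)) (H.pres-δ c) }
      where
        module G = Aut g
        module H = Aut h
        autCover : (k : Aut δ) → ∀ {x y} → x ⋖ y → Aut.to k x ⋖ Aut.to k y
        autCover k {x} {y} ((x≤y , x≢y) , btw) =
          (K.mono x≤y , λ e → x≢y (trans (sym (K.from-to x)) (trans (cong K.from e) (K.from-to y))))
          , λ z p q → Data.Sum.map
              (λ e → trans (sym (K.to-from z)) (cong K.to e))
              (λ e → trans (sym (K.to-from z)) (cong K.to e))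
              (btw (K.from z)
                   (K.reflects (subst (_ ≤_) (sym (K.to-from z)) p))
                   (K.reflects (subst (_≤ _) (sym (K.to-from z)) q)))
          where
            module K = Aut k

    inverseA : Aut δ → Aut δ
    inverseA g = record
      { to = G.from ; from = G.to ; to-from = G.from-to ; from-to = G.to-from
      ; mono = λ {x} {y} p → G.reflects (subst₂ _≤_ (sym (G.to-from x)) (sym (G.to-from y)) p)
      ; reflects = λ {x} {y} p → subst₂ _≤_ (G.to-from x) (G.to-from y) (G.mono p)
      ; pres-δ = λ {x} {y} c → sym (trans (cong₂ δ (sym (G.to-from x)) (sym (G.to-from y)))
                                 (G.pres-δ (fromCover c))) }
      where
        module G = Aut g
        fromCover : ∀ {x y} → x ⋖ y → G.from x ⋖ G.from y
        fromCover {x} {y} ((x≤y , x≢y) , btw) =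
          (G.reflects (subst₂ _≤_ (sym (G.to-from x)) (sym (G.to-from y)) x≤y)
          , λ e → x≢y (trans (sym (G.to-from x)) (trans (cong G.to e) (G.to-from y))))
          , λ z p q → Data.Sum.map
              (λ e → trans (sym (G.from-to z)) (cong G.from e))
              (λ e → trans (sym (G.from-to z)) (cong G.from e))
              (btw (G.to z)
                   (subst (_≤ G.to z) (G.to-from x) (G.mono p))
                   (subst (G.to z ≤_) (G.to-from y) (G.mono q)))

  record IsSubgroup (δ : Fin n → Fin n → ℤ) (G : Aut δ → Set) : Set where
    field
      id-∈  : G idAut
      ∘-∈   : ∀ {g h} → G g → G h → G (g ∘A h)
      inv-∈ : ∀ {g} → G g → G (inverseA g)

  module Quotient {δ : Fin n → Fin n → ℤ} (G : Aut δ → Set) where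
    _∼_ : Fin n → Fin n → Set
    q ∼ q' = Σ (Aut δ) λ g → G g × Aut.to g q ≡ q'

    -- Orbit(q) ≤ Orbit(q') in Q/G: some element of Orbit(q) is ≤ some element of Orbit(q')
    _≤/_ : Fin n → Fin n → Set
    q ≤/ q' = Σ (Aut δ) λ a → Σ (Aut δ) λ b → G a × G b × Aut.to a q ≤ Aut.to b q'

    _⋖/_ : Fin n → Fin n → Set
    q ⋖/ q' = (q ≤/ q' × ¬ (q ∼ q'))
              × (∀ r → q ≤/ r → r ≤/ q' → r ∼ q ⊎ r ∼ q')

-- An automorphism g preserves the rank, and in a finite poset g x ≤ x forces g x ≡ x,
-- so distinct members of an orbit are incomparable.  Hence O(q) ≤ O(q') can be realised
-- with q fixed, q ≤ g q', and a cover of orbits lifts to a cover q ⋖ g q'; the ranks of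
-- q and q' then differ by one, saturation makes them comparable, and either way q ⋖ q'.
-- Conversely, if q ⋖ q' and g q < r < h q', take a cover g q ⋖ p ≤ r: the rank of p
-- differs from that of h q by one, so p is comparable with h q, and both cases contradict
-- either the cover g q ⋖ p or the cover h q ⋖ h q'.  The labels agree because δ(p ⋖ p')
-- is the rank difference of p and p', which is constant along orbits.
module Submission where

open import Defs
open import Algebra.Properties.AbelianGroup using (xyx⁻¹≈y)
open import Data.Nat using (ℕ)
open import Data.Fin using (Fin; _≟_)
open import Data.Fin.Properties using (any?)
open import Data.Fin.Induction using (po-wellFounded; po-noetherian)
open import Data.Integer using (ℤ; _+_; _-_; ∣_∣; 0ℤ; 1ℤ; -1ℤ)
open import Data.Integer.Properties using (+-identityˡ; +-identityʳ; +-assoc; +-inverseʳ; +-0-abelianGroup)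
open import Data.Product using (_×_; _,_; ∃; proj₁; proj₂)
open import Data.Sum using (_⊎_; inj₁; inj₂; [_,_])
import Data.Sum as Sum
open import Data.Empty using (⊥-elim)
open import Function.Base using (flip; _∘_)
open import Function.Bundles using (_⇔_; mk⇔)
open import Induction.WellFounded using (Acc; acc; WellFounded)
open import Relation.Binary.Definitions using (Decidable)
open import Relation.Binary.PropositionalEquality
  using (_≡_; _≢_; refl; sym; trans; cong; cong₂; subst; module ≡-Reasoning)
open import Relation.Binary.Structures using (IsPartialOrder)
open import Relation.Nullary using (¬_; yes; no)
open import Relation.Nullary.Decidable using (_×-dec_)

module _ {n : ℕ} (Q : FinPoset n) where
  open FinPoset Q
  open IsPartialOrder isPartialOrder using (antisym) renaming (refl to ≤-refl; trans to ≤-trans)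

  private
    _⊏_ _≺_ : Fin n → Fin n → Set
    _⊏_ = _<_ Q
    _≺_ = _⋖_ Q

  ⊏-wellFounded : WellFounded _⊏_
  ⊏-wellFounded = po-wellFounded isPartialOrder

  ⊏-noetherian : WellFounded (flip _⊏_)
  ⊏-noetherian = po-noetherian isPartialOrder

  _⊏?_ : Decidable _⊏_
  x ⊏? y with x ≤? y | x ≟ y
  ... | yes x≤y | no x≢y = yes (x≤y , x≢y)
  ... | yes _   | yes x≡y = no λ x⊏y → proj₂ x⊏y x≡y
  ... | no x≰y  | _ = no (x≰y ∘ proj₁)

  nothing-between⇒⋖ : ∀ {x y} → x ⊏ y → (∀ z → ¬ (x ⊏ z × z ⊏ y)) → x ≺ y
  nothing-between⇒⋖ {x} {y} x⊏y ∄ = x⊏y , between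
    where
      between : ∀ z → x ≤ z → z ≤ y → z ≡ x ⊎ z ≡ y
      between z x≤z z≤y with z ≟ x | z ≟ y
      ... | yes z≡x | _ = inj₁ z≡x
      ... | no _ | yes z≡y = inj₂ z≡y
      ... | no z≢x | no z≢y = ⊥-elim (∄ z ((x≤z , z≢x ∘ sym) , (z≤y , z≢y)))

  <⇒∃≤⋖ : ∀ {x y} → x ⊏ y → ∃ λ w → x ≤ w × w ≺ y
  <⇒∃≤⋖ {x} = go x (⊏-noetherian x)
    where
      go : ∀ x → Acc (flip _⊏_) x → ∀ {y} → x ⊏ y → ∃ λ w → x ≤ w × w ≺ y
      go x (acc rec) {y} x⊏y with any? (λ w → (x ⊏? w) ×-dec (w ⊏? y))
      ... | yes (w , x⊏w , w⊏y) =
        let v , w≤v , v⋖y = go w (rec x⊏w) w⊏y in v , ≤-trans (proj₁ x⊏w) w≤v , v⋖y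
      ... | no ∄ = x , ≤-refl , nothing-between⇒⋖ x⊏y (λ z between → ∄ (z , between))

  <⇒∃⋖≤ : ∀ {x y} → x ⊏ y → ∃ λ w → x ≺ w × w ≤ y
  <⇒∃⋖≤ {y = y} = go y (⊏-wellFounded y)
    where
      go : ∀ y → Acc _⊏_ y → ∀ {x} → x ⊏ y → ∃ λ w → x ≺ w × w ≤ y
      go y (acc rec) {x} x⊏y with any? (λ w → (x ⊏? w) ×-dec (w ⊏? y))
      ... | yes (w , x⊏w , w⊏y) =
        let v , x⋖v , v≤w = go w (rec w⊏y) x⊏w in v , x⋖v , ≤-trans v≤w (proj₁ w⊏y)
      ... | no ∄ = y , nothing-between⇒⋖ x⊏y (λ z between → ∄ (z , between)) , ≤-refl

  _++_ : ∀ {x y z} → SatChain Q x y → SatChain Q y z → SatChain Q x z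
  single _ ++ d = d
  step e c ++ d = step e (c ++ d)

  maxChainBelow : ∀ y → MaxChainBelow Q y
  maxChainBelow y = go y (⊏-wellFounded y)
    where
      go : ∀ y → Acc _⊏_ y → MaxChainBelow Q y
      go y (acc rec) with any? (_⊏? y)
      ... | yes (z , z⊏y) =
        let w , _ , w⋖y = <⇒∃≤⋖ z⊏y
            m , m-minimal , c = go w (rec (proj₁ w⋖y))
        in m , m-minimal , c ++ step w⋖y (single y)
      ... | no ∄ = y , minimal , single y
        where
          minimal : IsMinimal Q y
          minimal z z≤y with z ≟ y
          ... | yes z≡y = z≡y
          ... | no z≢y = ⊥-elim (∄ (z , z≤y , z≢y))

  module _ (δ : Fin n → Fin n → ℤ) where

    chainSum-++ : ∀ {x y z} (c : SatChain Q x y) (d : SatChain Q y z) →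
                  chainSum Q δ (c ++ d) ≡ chainSum Q δ c + chainSum Q δ d
    chainSum-++ (single _) d = sym (+-identityˡ (chainSum Q δ d))
    chainSum-++ (step {x} {y} _ c) d = trans (cong (δ x y +_) (chainSum-++ c d))
                                             (sym (+-assoc (δ x y) (chainSum Q δ c) (chainSum Q δ d)))

    module _ (g : Aut Q δ) where
      open Aut g

      to-injective : ∀ {x y} → to x ≡ to y → x ≡ y
      to-injective {x} {y} e = trans (sym (from-to x)) (trans (cong from e) (from-to y))

      to-≤-from : ∀ {x y} → to x ≤ y → x ≤ from y
      to-≤-from {x} {y} le = reflects (subst (to x ≤_) (sym (to-from y)) le)

      ≤-to-from : ∀ {x y} → x ≤ to y → from x ≤ y
      ≤-to-from {x} {y} le = reflects (subst (_≤ to y) (sym (to-from x)) le)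

      to-< : ∀ {x y} → x ⊏ y → to x ⊏ to y
      to-< (x≤y , x≢y) = mono x≤y , x≢y ∘ to-injective

      to-⋖ : ∀ {x y} → x ≺ y → to x ≺ to y
      to-⋖ (x⊏y , between) = to-< x⊏y , λ z x≤z z≤y →
        Sum.map (λ e → trans (sym (to-from z)) (cong to e))
                (λ e → trans (sym (to-from z)) (cong to e))
                (between (from z) (to-≤-from x≤z) (≤-to-from z≤y))

      to-minimal : ∀ {x} → IsMinimal Q x → IsMinimal Q (to x)
      to-minimal x-minimal z z≤gx =
        trans (sym (to-from z)) (cong to (x-minimal (from z) (≤-to-from z≤gx)))

      mapChain : ∀ {x y} → SatChain Q x y → SatChain Q (to x) (to y)
      mapChain (single x) = single (to x)
      mapChain (step e c) = step (to-⋖ e) (mapChain c)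

      chainSum-mapChain : ∀ {x y} (c : SatChain Q x y) → chainSum Q δ (mapChain c) ≡ chainSum Q δ c
      chainSum-mapChain (single _) = refl
      chainSum-mapChain (step e c) = cong₂ _+_ (pres-δ e) (chainSum-mapChain c)

      to-≮ : ∀ x → ¬ (to x ⊏ x)
      to-≮ x = go x (⊏-wellFounded x)
        where
          go : ∀ x → Acc _⊏_ x → ¬ (to x ⊏ x)
          go x (acc rec) gx⊏x = go (to x) (rec gx⊏x) (to-< gx⊏x)

      to-≤⇒≡ : ∀ x → to x ≤ x → to x ≡ x
      to-≤⇒≡ x gx≤x with to x ≟ x
      ... | yes gx≡x = gx≡x
      ... | no gx≢x = ⊥-elim (to-≮ x (gx≤x , gx≢x))

    open Aut

    orbit-≤⇒≡ : (g h : Aut Q δ) → ∀ x → to g x ≤ to h x → to g x ≡ to h x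
    orbit-≤⇒≡ g h x gx≤hx = trans (sym (to-from h (to g x))) (cong (to h) h⁻¹gx≡x)
      where
        h⁻¹gx≡x : from h (to g x) ≡ x
        h⁻¹gx≡x = to-≤⇒≡ (_∘A_ Q (inverseA Q h) g) x (≤-to-from h gx≤hx)

    module _ (ρ : Fin n → ℤ) (rank : IsRankFunction Q δ ρ) where

      ⋖⇒ρ-step : ∀ {x y} → x ≺ y → ρ y - ρ x ≡ δ x y
      ⋖⇒ρ-step {x} {y} x⋖y with maxChainBelow x
      ... | m , m-minimal , c = begin
        ρ y - ρ x
          ≡⟨ cong (_- ρ x) (sym (rank y m m-minimal (c ++ step x⋖y (single y)))) ⟩
        chainSum Q δ (c ++ step x⋖y (single y)) - ρ x
          ≡⟨ cong (_- ρ x) (chainSum-++ c (step x⋖y (single y))) ⟩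
        chainSum Q δ c + (δ x y + 0ℤ) - ρ x
          ≡⟨ cong₂ (λ a b → a + b - ρ x) (rank x m m-minimal c) (+-identityʳ (δ x y)) ⟩
        ρ x + δ x y - ρ x
          ≡⟨ xyx⁻¹≈y +-0-abelianGroup (ρ x) (δ x y) ⟩
        δ x y
          ∎
        where open ≡-Reasoning

      ρ-invariant : (g : Aut Q δ) → ∀ x → ρ (to g x) ≡ ρ x
      ρ-invariant g x =
        let m , m-minimal , c = maxChainBelow x in
        trans (sym (rank (to g x) (to g m) (to-minimal g m-minimal) (mapChain g c)))
              (trans (chainSum-mapChain g c) (rank x m m-minimal c))

      module _ (labeling : IsEdgeLabeling Q δ) where

        ⋖⇒∣ρ-step∣≡1 : ∀ {x y} → x ≺ y → ∣ ρ y - ρ x ∣ ≡ 1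
        ⋖⇒∣ρ-step∣≡1 {x} {y} x⋖y =
          trans (cong ∣_∣ (⋖⇒ρ-step x⋖y)) ([ cong ∣_∣ , cong ∣_∣ ] (labeling x y x⋖y))

        ⋖⇒ρ≢ : ∀ {x y} → x ≺ y → ρ x ≢ ρ y
        ⋖⇒ρ≢ {x} {y} x⋖y ρx≡ρy =
          ±1≢0 (labeling x y x⋖y)
               (trans (sym (⋖⇒ρ-step x⋖y)) (trans (cong (ρ y -_) ρx≡ρy) (+-inverseʳ (ρ y))))
          where
            ±1≢0 : ∀ {d} → d ≡ 1ℤ ⊎ d ≡ -1ℤ → d ≢ 0ℤ
            ±1≢0 (inj₁ refl) ()
            ±1≢0 (inj₂ refl) ()

        module _ (saturated : IsSaturated Q ρ) where

          ⋖-orbit-interval : ∀ {q q' r} → q ≺ q' → (g h : Aut Q δ) →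
                             to g q ≤ r → r ≤ to h q' → r ≡ to g q ⊎ r ≡ to h q'
          ⋖-orbit-interval {q} {q'} {r} q⋖q' g h gq≤r r≤hq' with r ≟ to g q
          ... | yes r≡gq = inj₁ r≡gq
          ... | no r≢gq = inj₂ (through (<⇒∃⋖≤ (gq≤r , r≢gq ∘ sym)))
            where
              ρgq≡ρhq : ρ (to g q) ≡ ρ (to h q)
              ρgq≡ρhq = trans (ρ-invariant g q) (sym (ρ-invariant h q))

              through : (∃ λ p → to g q ≺ p × p ≤ r) → r ≡ to h q'
              through (p , gq⋖p , p≤r)
                with saturated (to h q) p
                               (subst (λ a → ∣ ρ p - a ∣ ≡ 1) ρgq≡ρhq (⋖⇒∣ρ-step∣≡1 gq⋖p))
              ... | inj₂ p≤hq = ⊥-elim (proj₂ (proj₁ gq⋖p) (antisym gq≤p p≤gq))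
                where
                  gq≤p : to g q ≤ p
                  gq≤p = proj₁ (proj₁ gq⋖p)

                  p≤gq : p ≤ to g q
                  p≤gq = subst (p ≤_) (sym (orbit-≤⇒≡ g h q (≤-trans gq≤p p≤hq))) p≤hq
              ... | inj₁ hq≤p with proj₂ (to-⋖ h q⋖q') p hq≤p (≤-trans p≤r r≤hq')
              ...   | inj₁ p≡hq = ⊥-elim (⋖⇒ρ≢ gq⋖p (trans ρgq≡ρhq (cong ρ (sym p≡hq))))
              ...   | inj₂ p≡hq' = antisym r≤hq' (subst (_≤ r) p≡hq' p≤r)

          module _ (G : Aut Q δ → Set) (subgroup : IsSubgroup Q δ G) where
            open IsSubgroup subgroup
            open Quotient Q G

            ≡to⇒∼ : ∀ {g r q} → G g → r ≡ to g q → r ∼ q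
            ≡to⇒∼ {g} {r} {q} g∈G r≡gq =
              inverseA Q g , inv-∈ g∈G , trans (cong (from g) r≡gq) (from-to g q)

            ∼⇒ρ≡ : ∀ {q r} → q ∼ r → ρ r ≡ ρ q
            ∼⇒ρ≡ {q} (g , _ , gq≡r) = trans (cong ρ (sym gq≡r)) (ρ-invariant g q)

            ≤/⇒translateˡ : ∀ {q r} → q ≤/ r → ∃ λ g → G g × to g q ≤ r
            ≤/⇒translateˡ (a , b , a∈G , b∈G , aq≤br) =
              _∘A_ Q (inverseA Q b) a , ∘-∈ (inv-∈ b∈G) a∈G , ≤-to-from b aq≤br

            ≤/⇒translateʳ : ∀ {q r} → q ≤/ r → ∃ λ g → G g × q ≤ to g r
            ≤/⇒translateʳ (a , b , a∈G , b∈G , aq≤br) =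
              _∘A_ Q (inverseA Q a) b , ∘-∈ (inv-∈ a∈G) b∈G , to-≤-from a aq≤br

            ⋖⇒⋖/ : ∀ {q q'} → q ≺ q' → q ⋖/ q'
            ⋖⇒⋖/ {q} {q'} q⋖q' = (q≤/q' , q≁q') , between
              where
                q≤/q' : q ≤/ q'
                q≤/q' = idAut Q , idAut Q , id-∈ , id-∈ , proj₁ (proj₁ q⋖q')

                q≁q' : ¬ (q ∼ q')
                q≁q' q∼q' = ⋖⇒ρ≢ q⋖q' (sym (∼⇒ρ≡ q∼q'))

                between : ∀ r → q ≤/ r → r ≤/ q' → r ∼ q ⊎ r ∼ q'
                between r q≤/r r≤/q' =
                  let g , g∈G , gq≤r = ≤/⇒translateˡ q≤/r
                      h , h∈G , r≤hq' = ≤/⇒translateʳ r≤/q'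
                  in Sum.map (≡to⇒∼ g∈G) (≡to⇒∼ h∈G) (⋖-orbit-interval q⋖q' g h gq≤r r≤hq')

            ⋖/⇒⋖-translate : ∀ {q q' g} → q ⋖/ q' → G g → q ≤ to g q' → q ≺ to g q'
            ⋖/⇒⋖-translate {q} {q'} {g} ((_ , q≁q') , between) g∈G q≤gq' =
              (q≤gq' , q≁q' ∘ ≡to⇒∼ g∈G) , between′
              where
                between′ : ∀ r → q ≤ r → r ≤ to g q' → r ≡ q ⊎ r ≡ to g q'
                between′ r q≤r r≤gq'
                  with between r (idAut Q , idAut Q , id-∈ , id-∈ , q≤r)
                                 (idAut Q , g , id-∈ , g∈G , r≤gq')
                ... | inj₁ (h , _ , hr≡q) =
                  inj₁ (trans (sym (orbit-≤⇒≡ h (idAut Q) r (subst (_≤ r) (sym hr≡q) q≤r))) hr≡q)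
                ... | inj₂ (h , _ , hr≡q') =
                  inj₂ (trans (orbit-≤⇒≡ (idAut Q) (_∘A_ Q g h) r
                                         (subst (r ≤_) (cong (to g) (sym hr≡q')) r≤gq'))
                              (cong (to g) hr≡q'))

            ⋖/⇒⋖ : ∀ {q q'} → q ⋖/ q' → q ≺ q'
            ⋖/⇒⋖ {q} {q'} q⋖/q' with ≤/⇒translateʳ (proj₁ (proj₁ q⋖/q'))
            ... | g , g∈G , q≤gq' =
              [ ⋖/⇒⋖-translate q⋖/q' id-∈ , q'≤q⇒q⋖q' ] (saturated q q' ∣ρq'-ρq∣≡1)
              where
                q⋖gq' : q ≺ to g q'
                q⋖gq' = ⋖/⇒⋖-translate q⋖/q' g∈G q≤gq'

                ∣ρq'-ρq∣≡1 : ∣ ρ q' - ρ q ∣ ≡ 1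
                ∣ρq'-ρq∣≡1 = subst (λ a → ∣ a - ρ q ∣ ≡ 1) (ρ-invariant g q') (⋖⇒∣ρ-step∣≡1 q⋖gq')

                q'≤q⇒q⋖q' : q' ≤ q → q ≺ q'
                q'≤q⇒q⋖q' q'≤q =
                  subst (q ≺_) (sym (orbit-≤⇒≡ (idAut Q) g q' (≤-trans q'≤q q≤gq'))) q⋖gq'

            ⋖/⇒δ-invariant : ∀ {q q'} → q ⋖/ q' →
                             ∀ p p' → q ∼ p → q' ∼ p' → p ≺ p' → δ p p' ≡ δ q q'
            ⋖/⇒δ-invariant {q} {q'} q⋖/q' p p' q∼p q'∼p' p⋖p' = begin
              δ p p'       ≡⟨ sym (⋖⇒ρ-step p⋖p') ⟩
              ρ p' - ρ p   ≡⟨ cong₂ _-_ (∼⇒ρ≡ q'∼p') (∼⇒ρ≡ q∼p) ⟩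
              ρ q' - ρ q   ≡⟨ ⋖⇒ρ-step (⋖/⇒⋖ q⋖/q') ⟩
              δ q q'       ∎
              where open ≡-Reasoning

corollary2p11 : ∀ {n : ℕ} (Q : FinPoset n) (δ : Fin n → Fin n → ℤ) (ρ : Fin n → ℤ)
    → IsEdgeLabeling Q δ
    → IsRankFunction Q δ ρ
    → IsSaturated Q ρ
    → (G : Aut Q δ → Set) → IsSubgroup Q δ G
    → ∀ (q q' : Fin n)
    → ((Quotient._⋖/_ Q G q q' ⇔ _⋖_ Q q q')
       × (Quotient._⋖/_ Q G q q' → ∀ (p p' : Fin n)
            → Quotient._∼_ Q G q p → Quotient._∼_ Q G q' p'
            → _⋖_ Q p p' → δ p p' ≡ δ q q'))
corollary2p11 Q δ ρ labeling rank saturated G subgroup q q' =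
  mk⇔ (⋖/⇒⋖ Q δ ρ rank labeling saturated G subgroup)
      (⋖⇒⋖/ Q δ ρ rank labeling saturated G subgroup) ,
  ⋖/⇒δ-invariant Q δ ρ rank labeling saturated G subgroup
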